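{- Under the Modified CFLS coloring $\varphi$ of $K_n$ ($n=2^{m^2}$), there are no five distinct vertices $a,b,c,d,e$ with $\varphi(be)=\varphi(cd)$, $\varphi(ab)=\varphi(de)$ and $\varphi(bc)=\varphi(ae)$.
   Context: Let $m$ be a positive integer and $n=2^{m^2}$. The vertices of $K_n$ are the binary strings $v\in\{0,1\}^{m^2}$, written as $v=(v^{(1)},\dots,v^{(m)})$ with each block $v^{(k)}\in\{0,1\}^m$. Vertices (and blocks) are linearly ordered as binary integers: $x<y$ iff at the first bit where they differ, $x$ has 0 and $y$ has 1. For $x<y$, let $i$ be the first index with $x^{(i)}\ne y^{(i)}$; for $k\in[m]$ let $i_k$ be the first position at which the bits of $x^{(k)}$ and $y^{(k)}$ differ ($i_k=0$ if $x^{(k)}=y^{(k)}$), and let $\delta_k=+1$ if $x^{(k)}\le y^{(k)}$ and $\delta_k=-1$ if $x^{(k)}>y^{(k)}$. The Modified CFLS coloring assigns to edge $xy$ the color $\varphi(xy)=((i,\{x^{(i)},y^{(i)}\}),i_1,\dots,i_m,\delta_1,\dots,\delta_m)$. -}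

module Defs where

open import Data.Nat using (ℕ; zero; suc)
open import Data.Bool using (Bool; true; false; if_then_else_)
open import Data.Vec using (Vec; []; _∷_; map; zipWith; concat)
open import Data.Vec.Properties using (≡-dec)
open import Data.Product using (_×_; _,_)
open import Data.Maybe using (Maybe; just; nothing)
open import Data.Sign using (Sign)
open import Relation.Nullary using (yes; no; ¬_)
open import Relation.Binary.PropositionalEquality using (_≡_)
import Data.Bool.Properties as BoolP

Block : ℕ → Set
Block m = Vec Bool m

-- A vertex of K_n, n = 2^(m^2): a binary string of length m^2,
-- written as m blocks of length m.  (concat gives the underlying string.)
Vertex : ℕ → Set
Vertex m = Vec (Block m) m

ltBits : ∀ {k} → Vec Bool k → Vec Bool k → Bool
ltBits [] [] = false
ltBits (false ∷ xs) (false ∷ ys) = ltBits xs ys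
ltBits (true ∷ xs) (true ∷ ys) = ltBits xs ys
ltBits (false ∷ xs) (true ∷ ys) = true
ltBits (true ∷ xs) (false ∷ ys) = false

-- Order on vertices: as binary integers (the full string of length m^2).
ltV : ∀ {m} → Vertex m → Vertex m → Bool
ltV x y = ltBits (concat x) (concat y)

-- First position (1-indexed) where two bit strings differ; 0 if equal.
firstDiffBits : ∀ {k} → Vec Bool k → Vec Bool k → ℕ
firstDiffBits [] [] = 0
firstDiffBits (a ∷ xs) (b ∷ ys) with a BoolP.≟ b
... | yes _ = rest
  where rest : ℕ
        rest with firstDiffBits xs ys
        ... | zero = zero
        ... | suc j = suc (suc j)
... | no _ = 1

-- First index i (1-indexed) with x^(i) ≠ y^(i), together with the
-- blocks (x^(i), y^(i)); 0 / nothing if x = y.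
firstDiffBlock : ∀ {m k} → Vec (Block m) k → Vec (Block m) k → ℕ × Maybe (Block m × Block m)
firstDiffBlock [] [] = 0 , nothing
firstDiffBlock (a ∷ xs) (b ∷ ys) with ≡-dec BoolP._≟_ a b
... | no _ = 1 , just (a , b)
... | yes _ with firstDiffBlock xs ys
...   | zero , p = zero , p
...   | suc j , p = suc (suc j) , p

-- The unordered pair {u, v} of blocks, represented canonically as (min, max).
unorderedPair : ∀ {m} → Block m × Block m → Block m × Block m
unorderedPair (u , v) = if ltBits v u then (v , u) else (u , v)

delta : ∀ {m} → Block m → Block m → Sign
delta u v = if ltBits v u then Sign.- else Sign.+

Colour : ℕ → Set
Colour m = (ℕ × Maybe (Block m × Block m)) × Vec ℕ m × Vec Sign m

-- Modified CFLS colour of the ordered pair (x, y), intended for x < y: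
-- ((i, {x^(i), y^(i)}), i_1..i_m, δ_1..δ_m).
phiOrd : ∀ {m} → Vertex m → Vertex m → Colour m
phiOrd x y with firstDiffBlock x y
... | i , p = (i , Data.Maybe.map unorderedPair p)
            , zipWith firstDiffBits x y
            , zipWith delta x y

phi : ∀ {m} → Vertex m → Vertex m → Colour m
phi x y = if ltV x y then phiOrd x y else phiOrd y x

Distinct5 : ∀ {A : Set} → A → A → A → A → A → Set
Distinct5 a b c d e =
  ¬ a ≡ b × ¬ a ≡ c × ¬ a ≡ d × ¬ a ≡ e ×
  ¬ b ≡ c × ¬ b ≡ d × ¬ b ≡ e ×
  ¬ c ≡ d × ¬ c ≡ e ×
  ¬ d ≡ e

{-# OPTIONS --safe #-}
-- Forgetting the signs δ, the colour of an edge xy is a symmetric function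
-- of x and y: the first block where they differ together with the unordered
-- pair of blocks there, and in every block the first differing bit.  Look at
-- the first block where b and e differ; there {b, e} = {c, d}.  If c = b and
-- d = e, the conditions force a = b and a = e in that block.  If c = e and
-- d = b, the blocks a, b, e pairwise first differ at the same position, which
-- is impossible for three binary strings unless two of them coincide; this
-- again forces b = e in that block.
module Submission where

open import Defs
open import Data.Nat using (ℕ; _≤_; zero; suc)
open import Data.Product using (_×_; _,_; proj₁; proj₂; map₁; map₂)
open import Data.Product.Properties using (,-injective; ,-injectiveʳ)
open import Data.Sum using (_⊎_; inj₁; inj₂)
open import Data.Bool using (Bool; true; false)
open import Data.Vec using (Vec; []; _∷_; zipWith; head; tail)
open import Data.Vec.Properties using (≡-dec; zipWith-comm)
open import Data.Maybe using (Maybe; just)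
import Data.Maybe as Maybe
open import Data.Maybe.Properties using (just-injective)
open import Data.Empty using (⊥-elim)
open import Relation.Nullary using (¬_; yes; no; Dec)
open import Relation.Binary.PropositionalEquality
  using (_≡_; _≢_; refl; sym; trans; cong; cong₂)
import Data.Bool.Properties as BoolP

-- Positions are 1-indexed with 0 meaning "no difference", so prepending a
-- common element shifts every position except 0.
liftPos : ℕ → ℕ
liftPos zero = zero
liftPos (suc j) = suc (suc j)

liftPos-injective : ∀ {i j} → liftPos i ≡ liftPos j → i ≡ j
liftPos-injective {zero} {zero} _ = refl
liftPos-injective {suc i} {suc j} refl = refl

liftPos≢1 : ∀ i → liftPos i ≢ 1
liftPos≢1 zero ()
liftPos≢1 (suc i) ()

liftPos≡0⇒≡0 : ∀ {i} → liftPos i ≡ 0 → i ≡ 0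
liftPos≡0⇒≡0 {zero} _ = refl

firstDiffBits-cons : ∀ {k} x (xs ys : Vec Bool k) →
  firstDiffBits (x ∷ xs) (x ∷ ys) ≡ liftPos (firstDiffBits xs ys)
firstDiffBits-cons true xs ys with firstDiffBits xs ys
... | zero = refl
... | suc j = refl
firstDiffBits-cons false xs ys with firstDiffBits xs ys
... | zero = refl
... | suc j = refl

firstDiffBits-cons≢1 : ∀ {k} x (xs ys : Vec Bool k) → firstDiffBits (x ∷ xs) (x ∷ ys) ≢ 1
firstDiffBits-cons≢1 x xs ys eq = liftPos≢1 _ (trans (sym (firstDiffBits-cons x xs ys)) eq)

firstDiffBits-cons-cong : ∀ {k} x (xs ys xs′ ys′ : Vec Bool k) →
  firstDiffBits xs ys ≡ firstDiffBits xs′ ys′ →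
  firstDiffBits (x ∷ xs) (x ∷ ys) ≡ firstDiffBits (x ∷ xs′) (x ∷ ys′)
firstDiffBits-cons-cong x xs ys xs′ ys′ eq =
  trans (firstDiffBits-cons x xs ys) (trans (cong liftPos eq) (sym (firstDiffBits-cons x xs′ ys′)))

firstDiffBits-comm : ∀ {k} (xs ys : Vec Bool k) → firstDiffBits xs ys ≡ firstDiffBits ys xs
firstDiffBits-comm [] [] = refl
firstDiffBits-comm (true ∷ xs) (true ∷ ys) = firstDiffBits-cons-cong true xs ys ys xs (firstDiffBits-comm xs ys)
firstDiffBits-comm (false ∷ xs) (false ∷ ys) = firstDiffBits-cons-cong false xs ys ys xs (firstDiffBits-comm xs ys)
firstDiffBits-comm (true ∷ xs) (false ∷ ys) = refl
firstDiffBits-comm (false ∷ xs) (true ∷ ys) = refl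

firstDiffBits-self : ∀ {k} (xs : Vec Bool k) → firstDiffBits xs xs ≡ 0
firstDiffBits-self [] = refl
firstDiffBits-self (x ∷ xs) = trans (firstDiffBits-cons x xs xs) (cong liftPos (firstDiffBits-self xs))

firstDiffBits≡0⇒≡ : ∀ {k} (xs ys : Vec Bool k) → firstDiffBits xs ys ≡ 0 → xs ≡ ys
firstDiffBits≡0⇒≡ [] [] _ = refl
firstDiffBits≡0⇒≡ (true ∷ xs) (true ∷ ys) eq = cong (true ∷_) (firstDiffBits≡0⇒≡ xs ys
  (liftPos≡0⇒≡0 (trans (sym (firstDiffBits-cons true xs ys)) eq)))
firstDiffBits≡0⇒≡ (false ∷ xs) (false ∷ ys) eq = cong (false ∷_) (firstDiffBits≡0⇒≡ xs ys
  (liftPos≡0⇒≡0 (trans (sym (firstDiffBits-cons false xs ys)) eq)))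
firstDiffBits≡0⇒≡ (true ∷ xs) (false ∷ ys) ()
firstDiffBits≡0⇒≡ (false ∷ xs) (true ∷ ys) ()

-- With only two letters, three strings cannot pairwise first differ at one
-- and the same position.
firstDiffBits-equilateral⇒≡ : ∀ {k} (a b e : Vec Bool k) →
  firstDiffBits a b ≡ firstDiffBits b e → firstDiffBits a e ≡ firstDiffBits b e → b ≡ e
firstDiffBits-equilateral⇒≡ [] [] [] _ _ = refl
firstDiffBits-equilateral⇒≡ (x ∷ a) (y ∷ b) (z ∷ e) = cases x y z
  where
  sameHead : ∀ w → firstDiffBits (w ∷ a) (w ∷ b) ≡ firstDiffBits (w ∷ b) (w ∷ e) →
    firstDiffBits (w ∷ a) (w ∷ e) ≡ firstDiffBits (w ∷ b) (w ∷ e) → w ∷ b ≡ w ∷ e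
  sameHead w ab≡be ae≡be = cong (w ∷_) (firstDiffBits-equilateral⇒≡ a b e
    (liftPos-injective (trans (sym (firstDiffBits-cons w a b)) (trans ab≡be (firstDiffBits-cons w b e))))
    (liftPos-injective (trans (sym (firstDiffBits-cons w a e)) (trans ae≡be (firstDiffBits-cons w b e)))))

  -- Otherwise exactly one of the three pairs agrees in its head: its first
  -- difference is then > 1, while that of a pair it is compared with is 1.
  cases : ∀ x y z → firstDiffBits (x ∷ a) (y ∷ b) ≡ firstDiffBits (y ∷ b) (z ∷ e) →
    firstDiffBits (x ∷ a) (z ∷ e) ≡ firstDiffBits (y ∷ b) (z ∷ e) → y ∷ b ≡ z ∷ e
  cases true  true  true  = sameHead true
  cases false false false = sameHead false
  cases true  true  false ab≡be _ = ⊥-elim (firstDiffBits-cons≢1 true a b ab≡be)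
  cases false false true  ab≡be _ = ⊥-elim (firstDiffBits-cons≢1 false a b ab≡be)
  cases true  false true  _ ae≡be = ⊥-elim (firstDiffBits-cons≢1 true a e ae≡be)
  cases false true  false _ ae≡be = ⊥-elim (firstDiffBits-cons≢1 false a e ae≡be)
  cases false true  true  ab≡be _ = ⊥-elim (firstDiffBits-cons≢1 true b e (sym ab≡be))
  cases true  false false ab≡be _ = ⊥-elim (firstDiffBits-cons≢1 false b e (sym ab≡be))

ltBits-asym : ∀ {k} (u v : Vec Bool k) → ltBits u v ≡ true → ltBits v u ≢ true
ltBits-asym [] [] ()
ltBits-asym (true ∷ u) (true ∷ v) = ltBits-asym u v
ltBits-asym (false ∷ u) (false ∷ v) = ltBits-asym u v
ltBits-asym (false ∷ u) (true ∷ v) _ ()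

ltBits-trichotomy : ∀ {k} (u v : Vec Bool k) → ltBits u v ≡ false → ltBits v u ≡ false → u ≡ v
ltBits-trichotomy [] [] _ _ = refl
ltBits-trichotomy (true ∷ u) (true ∷ v) p q = cong (true ∷_) (ltBits-trichotomy u v p q)
ltBits-trichotomy (false ∷ u) (false ∷ v) p q = cong (false ∷_) (ltBits-trichotomy u v p q)
ltBits-trichotomy (true ∷ u) (false ∷ v) _ ()
ltBits-trichotomy (false ∷ u) (true ∷ v) ()

unorderedPair-comm : ∀ {m} (u v : Block m) → unorderedPair (u , v) ≡ unorderedPair (v , u)
unorderedPair-comm u v with ltBits v u in v<u | ltBits u v in u<v
... | true  | true  = ⊥-elim (ltBits-asym u v u<v v<u)
... | true  | false = refl
... | false | true  = refl
... | false | false with ltBits-trichotomy u v u<v v<u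
...   | refl = refl

unorderedPair-≡⇒ : ∀ {m} (b e c d : Block m) → unorderedPair (b , e) ≡ unorderedPair (c , d) →
  (b ≡ c × e ≡ d) ⊎ (b ≡ d × e ≡ c)
unorderedPair-≡⇒ b e c d eq with ltBits e b | ltBits d c
... | true  | true  = inj₁ (cong proj₂ eq , cong proj₁ eq)
... | true  | false = inj₂ (cong proj₂ eq , cong proj₁ eq)
... | false | true  = inj₂ (cong proj₁ eq , cong proj₂ eq)
... | false | false = inj₁ (cong proj₁ eq , cong proj₂ eq)

firstDiffBits-pentagon : ∀ {m} (a b c d e : Block m) →
  unorderedPair (b , e) ≡ unorderedPair (c , d) →
  firstDiffBits a b ≡ firstDiffBits d e → firstDiffBits b c ≡ firstDiffBits a e → b ≡ e
firstDiffBits-pentagon a b c d e be≡cd ab≡de bc≡ae with unorderedPair-≡⇒ b e c d be≡cd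
... | inj₁ (refl , refl) =
  trans (sym (firstDiffBits≡0⇒≡ a b (trans ab≡de (firstDiffBits-self e))))
        (firstDiffBits≡0⇒≡ a e (trans (sym bc≡ae) (firstDiffBits-self b)))
... | inj₂ (refl , refl) = firstDiffBits-equilateral⇒≡ a b e ab≡de (sym bc≡ae)

FirstBlock : ℕ → Set
FirstBlock m = ℕ × Maybe (Block m × Block m)

firstDiffBlockPair : ∀ {m k} → Vec (Block m) k → Vec (Block m) k → FirstBlock m
firstDiffBlockPair x y = map₂ (Maybe.map unorderedPair) (firstDiffBlock x y)

firstDiffBlockPair-cons : ∀ {m k} (u : Block m) (xs ys : Vec (Block m) k) →
  firstDiffBlockPair (u ∷ xs) (u ∷ ys) ≡ map₁ liftPos (firstDiffBlockPair xs ys)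
firstDiffBlockPair-cons u xs ys with ≡-dec BoolP._≟_ u u
... | no u≢u = ⊥-elim (u≢u refl)
... | yes _ with firstDiffBlock xs ys
...   | zero , p = refl
...   | suc j , p = refl

firstDiffBlockPair-cons-≢ : ∀ {m k} {u v : Block m} (xs ys : Vec (Block m) k) → u ≢ v →
  firstDiffBlockPair (u ∷ xs) (v ∷ ys) ≡ (1 , just (unorderedPair (u , v)))
firstDiffBlockPair-cons-≢ {u = u} {v} xs ys u≢v with ≡-dec BoolP._≟_ u v
... | no _ = refl
... | yes u≡v = ⊥-elim (u≢v u≡v)

firstDiffBlockPair-comm : ∀ {m k} (x y : Vec (Block m) k) → firstDiffBlockPair x y ≡ firstDiffBlockPair y x
firstDiffBlockPair-comm [] [] = refl
firstDiffBlockPair-comm (u ∷ xs) (v ∷ ys) = byHeads (≡-dec BoolP._≟_ u v)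
  where
  byHeads : Dec (u ≡ v) → firstDiffBlockPair (u ∷ xs) (v ∷ ys) ≡ firstDiffBlockPair (v ∷ ys) (u ∷ xs)
  byHeads (yes refl) = trans (firstDiffBlockPair-cons u xs ys)
    (trans (cong (map₁ liftPos) (firstDiffBlockPair-comm xs ys)) (sym (firstDiffBlockPair-cons u ys xs)))
  byHeads (no u≢v) = trans (firstDiffBlockPair-cons-≢ xs ys u≢v)
    (trans (cong (λ q → 1 , just q) (unorderedPair-comm u v))
           (sym (firstDiffBlockPair-cons-≢ ys xs (λ v≡u → u≢v (sym v≡u)))))

map₁-liftPos≢1 : ∀ {m} (r : FirstBlock m) q → map₁ liftPos r ≢ (1 , q)
map₁-liftPos≢1 (i , _) _ eq = liftPos≢1 i (cong proj₁ eq)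

map₁-liftPos-injective : ∀ {m} {r s : FirstBlock m} → map₁ liftPos r ≡ map₁ liftPos s → r ≡ s
map₁-liftPos-injective {r = i , p} {j , q} eq with ,-injective eq
... | i≡j , refl = cong (_, p) (liftPos-injective i≡j)

firstDiffBlocks-pentagon : ∀ {m k} (a b c d e : Vec (Block m) k) →
  firstDiffBlockPair b e ≡ firstDiffBlockPair c d →
  zipWith firstDiffBits a b ≡ zipWith firstDiffBits d e →
  zipWith firstDiffBits b c ≡ zipWith firstDiffBits a e → b ≡ e
firstDiffBlocks-pentagon [] [] [] [] [] _ _ _ = refl
firstDiffBlocks-pentagon (a₀ ∷ as) (b₀ ∷ bs) (c₀ ∷ cs) (d₀ ∷ ds) (e₀ ∷ es) be≡cd ab≡de bc≡ae =
  byHeads (≡-dec BoolP._≟_ b₀ e₀) (≡-dec BoolP._≟_ c₀ d₀)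
  where
  byHeads : Dec (b₀ ≡ e₀) → Dec (c₀ ≡ d₀) → b₀ ∷ bs ≡ e₀ ∷ es
  byHeads (yes refl) (yes refl) = cong (b₀ ∷_) (firstDiffBlocks-pentagon as bs cs ds es
    (map₁-liftPos-injective
      (trans (sym (firstDiffBlockPair-cons b₀ bs es)) (trans be≡cd (firstDiffBlockPair-cons c₀ cs ds))))
    (cong tail ab≡de) (cong tail bc≡ae))
  byHeads (yes refl) (no c₀≢d₀) = ⊥-elim (map₁-liftPos≢1 _ _
    (trans (sym (firstDiffBlockPair-cons b₀ bs es)) (trans be≡cd (firstDiffBlockPair-cons-≢ cs ds c₀≢d₀))))
  byHeads (no b₀≢e₀) (yes refl) = ⊥-elim (map₁-liftPos≢1 _ _
    (trans (sym (firstDiffBlockPair-cons c₀ cs ds)) (trans (sym be≡cd) (firstDiffBlockPair-cons-≢ bs es b₀≢e₀))))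
  byHeads (no b₀≢e₀) (no c₀≢d₀) = ⊥-elim (b₀≢e₀ (firstDiffBits-pentagon a₀ b₀ c₀ d₀ e₀
    (just-injective (,-injectiveʳ
      (trans (sym (firstDiffBlockPair-cons-≢ bs es b₀≢e₀)) (trans be≡cd (firstDiffBlockPair-cons-≢ cs ds c₀≢d₀)))))
    (cong head ab≡de) (cong head bc≡ae)))

UnsignedColour : ℕ → Set
UnsignedColour m = FirstBlock m × Vec ℕ m

dropSigns : ∀ {m} → Colour m → UnsignedColour m
dropSigns (p , z , _) = p , z

unsignedColour : ∀ {m} → Vertex m → Vertex m → UnsignedColour m
unsignedColour x y = firstDiffBlockPair x y , zipWith firstDiffBits x y

unsignedColour-comm : ∀ {m} (x y : Vertex m) → unsignedColour x y ≡ unsignedColour y x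
unsignedColour-comm x y =
  cong₂ _,_ (firstDiffBlockPair-comm x y) (zipWith-comm firstDiffBits-comm x y)

dropSigns-phiOrd : ∀ {m} (x y : Vertex m) → dropSigns (phiOrd x y) ≡ unsignedColour x y
dropSigns-phiOrd x y with firstDiffBlock x y
... | _ = refl

dropSigns-phi : ∀ {m} (x y : Vertex m) → dropSigns (phi x y) ≡ unsignedColour x y
dropSigns-phi x y with ltV x y
... | true  = dropSigns-phiOrd x y
... | false = trans (dropSigns-phiOrd y x) (unsignedColour-comm y x)

lemma8 : (m : ℕ) → 1 ≤ m → (a b c d e : Vertex m) → Distinct5 a b c d e →
    ¬ (phi b e ≡ phi c d × phi a b ≡ phi d e × phi b c ≡ phi a e)
lemma8 m _ a b c d e (_ , _ , _ , _ , _ , _ , b≢e , _) (be≡cd , ab≡de , bc≡ae) =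
  b≢e (firstDiffBlocks-pentagon a b c d e
    (cong proj₁ (unsigned be≡cd)) (cong proj₂ (unsigned ab≡de)) (cong proj₂ (unsigned bc≡ae)))
  where
  unsigned : ∀ {x y u v : Vertex m} → phi x y ≡ phi u v → unsignedColour x y ≡ unsignedColour u v
  unsigned {x} {y} {u} {v} eq =
    trans (sym (dropSigns-phi x y)) (trans (cong dropSigns eq) (dropSigns-phi u v))
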